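{- For every $\alpha\in Fm''$: if $\not\models_{\cal TML}\alpha$, then every completed tableau of $\mathbb T$ for $F(\alpha)$ is open.
   Context: $M_4=\{\mathbf 0,\mathbf n,\mathbf b,\mathbf 1\}$ with $\neg\mathbf 0=\mathbf 1$, $\neg\mathbf 1=\mathbf 0$, $\neg\mathbf n=\mathbf n$, $\neg\mathbf b=\mathbf b$ and $\succ$: $\mathbf 0\succ y=\mathbf 1$; $\mathbf n\succ\mathbf 0=\mathbf n$, $\mathbf n\succ\mathbf n=\mathbf 1$, $\mathbf n\succ\mathbf b=\mathbf b$, $\mathbf n\succ\mathbf 1=\mathbf 1$; $\mathbf b\succ\mathbf 0=\mathbf b$, $\mathbf b\succ\mathbf n=\mathbf n$, $\mathbf b\succ\mathbf b=\mathbf 1$, $\mathbf b\succ\mathbf 1=\mathbf 1$; $\mathbf 1\succ y=y$. Formulas of $Fm''$ are built from propositional variables with $\neg$, $\succ$; a valuation is a homomorphism $h:Fm''\to M_4$; $\models_{\cal TML}\alpha$ means $h(\alpha)=\mathbf 1$ for every valuation $h$. Signed formulas are $T(\alpha)$, $F(\alpha)$. Rules of $\mathbb T$ (premise $\Rightarrow$ conclusion sets separated by $|$): $T(\alpha\succ\beta)\Rightarrow \{T(\beta)\}\,|\,\{T(\neg\alpha),F(\beta),T(\neg\beta)\}\,|\,\{F(\alpha),F(\beta),F(\neg\beta)\}$; $F(\alpha\succ\beta)\Rightarrow\{T(\alpha),F(\beta),F(\neg\beta)\}\,|\,\{F(\neg\alpha),F(\beta),T(\neg\beta)\}$; $T(\neg(\alpha\succ\beta))\Rightarrow\{T(\alpha),F(\beta),T(\neg\beta)\}\,|\,\{F(\neg\alpha),T(\beta),T(\neg\beta)\}$;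 $F(\neg(\alpha\succ\beta))\Rightarrow\{F(\neg\beta)\}\,|\,\{T(\neg\alpha),T(\beta),T(\neg\beta)\}\,|\,\{F(\alpha),F(\beta),T(\neg\beta)\}$; $T(\neg\neg\alpha)\Rightarrow\{T(\alpha)\}$; $F(\neg\neg\alpha)\Rightarrow\{F(\alpha)\}$. A tableau for $\eta$ is a finite tree with root $\eta$ built by repeatedly choosing a non-closed branch and a signed formula on it that is a rule premise, and extending the branch by one sub-branch per conclusion set. A branch is closed if it contains $T(\gamma)$ and $F(\gamma)$ for some $\gamma$; a tableau is closed if all branches are closed, open otherwise; it is completed if on every non-closed branch every rule whose premise occurs on the branch has been applied to it along that branch. -}

module Defs where

open import Data.Nat using (ℕ)
open import Data.List using (List; []; _∷_; _++_; map)
open import Data.List.Membership.Propositional using (_∈_)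
open import Data.List.Relation.Unary.Any using (Any)
open import Data.Product using (Σ; _×_; ∃; ∃-syntax)
open import Relation.Nullary using (¬_)
open import Relation.Binary.PropositionalEquality using (_≡_)

data M4 : Set where
  𝟎 𝐧 𝐛 𝟏 : M4

¬ᴹ : M4 → M4
¬ᴹ 𝟎 = 𝟏
¬ᴹ 𝐧 = 𝐧
¬ᴹ 𝐛 = 𝐛
¬ᴹ 𝟏 = 𝟎

_≻ᴹ_ : M4 → M4 → M4
𝟎 ≻ᴹ y = 𝟏
𝐧 ≻ᴹ 𝟎 = 𝐧
𝐧 ≻ᴹ 𝐧 = 𝟏
𝐧 ≻ᴹ 𝐛 = 𝐛
𝐧 ≻ᴹ 𝟏 = 𝟏
𝐛 ≻ᴹ 𝟎 = 𝐛
𝐛 ≻ᴹ 𝐧 = 𝐧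
𝐛 ≻ᴹ 𝐛 = 𝟏
𝐛 ≻ᴹ 𝟏 = 𝟏
𝟏 ≻ᴹ y = y

data Fm : Set where
  var  : ℕ → Fm
  ~_   : Fm → Fm
  _⊃_  : Fm → Fm → Fm

⟦_⟧ : Fm → (ℕ → M4) → M4
⟦ var p ⟧ v = v p
⟦ ~ a ⟧ v = ¬ᴹ (⟦ a ⟧ v)
⟦ a ⊃ b ⟧ v = ⟦ a ⟧ v ≻ᴹ ⟦ b ⟧ v

Valid : Fm → Set
Valid α = (v : ℕ → M4) → ⟦ α ⟧ v ≡ 𝟏

data SFm : Set where
  T F : Fm → SFm

-- Rules of 𝕋: Rule φ Cs means φ is a premise with list Cs of conclusion sets
data Rule : SFm → List (List SFm) → Set where
  T≻  : ∀ a b → Rule (T (a ⊃ b))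
          ((T b ∷ []) ∷ (T (~ a) ∷ F b ∷ T (~ b) ∷ []) ∷ (F a ∷ F b ∷ F (~ b) ∷ []) ∷ [])
  F≻  : ∀ a b → Rule (F (a ⊃ b))
          ((T a ∷ F b ∷ F (~ b) ∷ []) ∷ (F (~ a) ∷ F b ∷ T (~ b) ∷ []) ∷ [])
  T¬≻ : ∀ a b → Rule (T (~ (a ⊃ b)))
          ((T a ∷ F b ∷ T (~ b) ∷ []) ∷ (F (~ a) ∷ T b ∷ T (~ b) ∷ []) ∷ [])
  F¬≻ : ∀ a b → Rule (F (~ (a ⊃ b)))
          ((F (~ b) ∷ []) ∷ (T (~ a) ∷ T b ∷ T (~ b) ∷ []) ∷ (F a ∷ F b ∷ T (~ b) ∷ []) ∷ [])
  T¬¬ : ∀ a → Rule (T (~ (~ a))) ((T a ∷ []) ∷ [])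
  F¬¬ : ∀ a → Rule (F (~ (~ a))) ((F a ∷ []) ∷ [])

IsPremise : SFm → Set
IsPremise φ = ∃[ Cs ] Rule φ Cs

-- A branch: the signed formulas on it (root to leaf), together with the list of
-- premises to which a rule has been applied along this branch.
record Branch : Set where
  constructor br
  field
    nodes   : List SFm
    applied : List SFm
open Branch public

Closed : Branch → Set
Closed b = ∃[ γ ] (T γ ∈ nodes b × F γ ∈ nodes b)

extend : Branch → SFm → List (List SFm) → List Branch
extend b φ Cs = map (λ C → br (nodes b ++ C) (φ ∷ applied b)) Cs

data Tableau (η : SFm) : List Branch → Set where
  root : Tableau η (br (η ∷ []) [] ∷ [])
  step : ∀ {bs₁ bs₂ b φ Cs} →
         Tableau η (bs₁ ++ b ∷ bs₂) →
         ¬ Closed b → φ ∈ nodes b → Rule φ Cs →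
         Tableau η (bs₁ ++ extend b φ Cs ++ bs₂)

Completed : List Branch → Set
Completed bs = ∀ b → b ∈ bs → ¬ Closed b → ∀ φ → φ ∈ nodes b → IsPremise φ → φ ∈ applied b

Open : List Branch → Set
Open bs = ∃[ b ] (b ∈ bs × ¬ Closed b)

module Submission where

-- Read T α as "α takes a designated value in {𝐛, 𝟏}" and F α as its negation.
-- Every rule of 𝕋 is sound for this reading, so a valuation satisfying the root
-- satisfies every node of some branch, which therefore cannot be closed; the
-- tableau need not be completed.  If α is not valid, then ⟦ α ⟧ v ≠ 𝟏 for some v,
-- and as swapping 𝐧 and 𝐛 is an automorphism of M4, v or its swap gives α an
-- undesignated value and satisfies F α.  Such a v cannot be exhibited from ¬ Valid α,
-- so one decides whether the tableau is open and otherwise concludes Valid α.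

open import Defs
open import Data.Bool using (Bool; true; false; not; _∨_) renaming (T to IsTrue)
open import Data.Empty using (⊥)
open import Data.Nat as ℕ using (ℕ; zero; suc)
open import Data.List using (List; []; _∷_)
open import Data.Bool.ListAction using (all; any)
open import Data.List.Membership.Propositional using (_∈_; find; lose)
open import Data.List.Relation.Unary.All as All using (All; _∷_)
open import Data.List.Relation.Unary.All.Properties using (all⁺; ++⁺)
open import Data.List.Relation.Unary.Any as Any using (Any; here; there; any?)
open import Data.List.Relation.Unary.Any.Properties using (any⁻; ++⁺ˡ; ++⁺ʳ; ++⁻; map⁺)
open import Data.Product using (_,_)
open import Data.Sum using (inj₁; inj₂)
open import Function using (_∘_)
open import Relation.Binary.Definitions using (DecidableEquality)
open import Relation.Binary.PropositionalEquality using (_≡_; refl; sym; trans; cong; cong₂; subst)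
open import Relation.Nullary using (¬_; Dec; no; ¬?; decidable-stable)
open import Relation.Nullary.Decidable using (map′; _×-dec_)

designated : M4 → Bool
designated 𝐛 = true
designated 𝟏 = true
designated _ = false

satisfiesᵇ : (ℕ → M4) → SFm → Bool
satisfiesᵇ v (T a) = designated (⟦ a ⟧ v)
satisfiesᵇ v (F a) = not (designated (⟦ a ⟧ v))

Satisfies : (ℕ → M4) → SFm → Set
Satisfies v φ = IsTrue (satisfiesᵇ v φ)

SatisfiedBy : (ℕ → M4) → Branch → Set
SatisfiedBy v b = All (Satisfies v) (nodes b)

modus-ponensᵇ : ∀ {p q} → IsTrue (not p ∨ q) → IsTrue p → IsTrue q
modus-ponensᵇ {true} p→q _ = p→q

IsTrue-not⇒¬IsTrue : ∀ p → IsTrue (not p) → ¬ IsTrue p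
IsTrue-not⇒¬IsTrue true () _

¬IsTrue-not⇒IsTrue : ∀ p → ¬ IsTrue (not p) → IsTrue p
¬IsTrue-not⇒IsTrue true  _ = _
¬IsTrue-not⇒IsTrue false h = h _

m4-values : List M4
m4-values = 𝟎 ∷ 𝐧 ∷ 𝐛 ∷ 𝟏 ∷ []

∈-m4-values : ∀ x → x ∈ m4-values
∈-m4-values 𝟎 = here refl
∈-m4-values 𝐧 = there (here refl)
∈-m4-values 𝐛 = there (there (here refl))
∈-m4-values 𝟏 = there (there (there (here refl)))

all-pairs : (M4 → M4 → Bool) → Bool
all-pairs p = all (λ x → all (p x) m4-values) m4-values

all-pairs-sound : ∀ p → IsTrue (all-pairs p) → ∀ x y → IsTrue (p x y)
all-pairs-sound p h x y = All.lookup (all⁺ (p x) m4-values row-x) (∈-m4-values y)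
  where
  row-x : IsTrue (all (p x) m4-values)
  row-x = All.lookup (all⁺ (λ x′ → all (p x′) m4-values) m4-values h) (∈-m4-values x)

preserves-satisfactionᵇ : (ℕ → M4) → ∀ {φ Cs} → Rule φ Cs → Bool
preserves-satisfactionᵇ v {φ} {Cs} _ = not (satisfiesᵇ v φ) ∨ any (all (satisfiesᵇ v)) Cs

valuation₀₁ : M4 → M4 → ℕ → M4
valuation₀₁ x y zero          = x
valuation₀₁ x y (suc zero)    = y
valuation₀₁ x y (suc (suc _)) = 𝟎

schematic-sound : ∀ {φ Cs} (r : Rule φ Cs) →
  IsTrue (all-pairs λ x y → preserves-satisfactionᵇ (valuation₀₁ x y) r) →
  ∀ x y → IsTrue (preserves-satisfactionᵇ (valuation₀₁ x y) r)
schematic-sound r = all-pairs-sound (λ x y → preserves-satisfactionᵇ (valuation₀₁ x y) r)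

-- An instance of a rule at a and b is evaluated under v exactly as its schematic
-- instance at var 0 and var 1 under valuation₀₁ (⟦ a ⟧ v) (⟦ b ⟧ v), so each rule
-- is checked once and for all on the sixteen pairs of values.
rule-soundᵇ : ∀ v {φ Cs} (r : Rule φ Cs) → IsTrue (preserves-satisfactionᵇ v r)
rule-soundᵇ v (T≻ a b)  = schematic-sound (T≻ (var 0) (var 1)) _ (⟦ a ⟧ v) (⟦ b ⟧ v)
rule-soundᵇ v (F≻ a b)  = schematic-sound (F≻ (var 0) (var 1)) _ (⟦ a ⟧ v) (⟦ b ⟧ v)
rule-soundᵇ v (T¬≻ a b) = schematic-sound (T¬≻ (var 0) (var 1)) _ (⟦ a ⟧ v) (⟦ b ⟧ v)
rule-soundᵇ v (F¬≻ a b) = schematic-sound (F¬≻ (var 0) (var 1)) _ (⟦ a ⟧ v) (⟦ b ⟧ v)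
rule-soundᵇ v (T¬¬ a)   = schematic-sound (T¬¬ (var 0)) _ (⟦ a ⟧ v) 𝟎
rule-soundᵇ v (F¬¬ a)   = schematic-sound (F¬¬ (var 0)) _ (⟦ a ⟧ v) 𝟎

rule-sound : ∀ v {φ Cs} → Rule φ Cs → Satisfies v φ → Any (All (Satisfies v)) Cs
rule-sound v {φ} {Cs} r sat =
  Any.map (all⁺ (satisfiesᵇ v) _) (any⁻ _ Cs (modus-ponensᵇ {satisfiesᵇ v φ} (rule-soundᵇ v r) sat))

extend-satisfied : ∀ v {b φ Cs} → SatisfiedBy v b → φ ∈ nodes b → Rule φ Cs →
  Any (SatisfiedBy v) (extend b φ Cs)
extend-satisfied v sb φ∈b r = map⁺ (Any.map (++⁺ sb) (rule-sound v r (All.lookup sb φ∈b)))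

satisfied-branch : ∀ v {η bs} → Tableau η bs → Satisfies v η → Any (SatisfiedBy v) bs
satisfied-branch v root sη = here (sη ∷ All.[])
satisfied-branch v (step {bs₁} {bs₂} {b} {φ} {Cs} t _ φ∈b r) sη
  with ++⁻ bs₁ (satisfied-branch v t sη)
... | inj₁ in-bs₁          = ++⁺ˡ in-bs₁
... | inj₂ (there in-bs₂)  = ++⁺ʳ bs₁ (++⁺ʳ (extend b φ Cs) in-bs₂)
... | inj₂ (here sb)       = ++⁺ʳ bs₁ (++⁺ˡ (extend-satisfied v sb φ∈b r))

satisfied⇒¬closed : ∀ v {b} → SatisfiedBy v b → ¬ Closed b
satisfied⇒¬closed v sb (γ , Tγ∈b , Fγ∈b) =
  IsTrue-not⇒¬IsTrue (designated (⟦ γ ⟧ v)) (All.lookup sb Fγ∈b) (All.lookup sb Tγ∈b)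

¬open⇒unsatisfiable : ∀ v {η bs} → Tableau η bs → ¬ Open bs → ¬ Satisfies v η
¬open⇒unsatisfiable v t ¬open sη =
  let b , b∈bs , sb = find (satisfied-branch v t sη)
  in ¬open (b , b∈bs , satisfied⇒¬closed v {b} sb)

swap : M4 → M4
swap 𝐧 = 𝐛
swap 𝐛 = 𝐧
swap x = x

swap-¬ᴹ : ∀ x → swap (¬ᴹ x) ≡ ¬ᴹ (swap x)
swap-¬ᴹ 𝟎 = refl
swap-¬ᴹ 𝐧 = refl
swap-¬ᴹ 𝐛 = refl
swap-¬ᴹ 𝟏 = refl

swap-≻ᴹ : ∀ x y → swap (x ≻ᴹ y) ≡ swap x ≻ᴹ swap y
swap-≻ᴹ 𝟎 y = refl
swap-≻ᴹ 𝐧 𝟎 = refl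
swap-≻ᴹ 𝐧 𝐧 = refl
swap-≻ᴹ 𝐧 𝐛 = refl
swap-≻ᴹ 𝐧 𝟏 = refl
swap-≻ᴹ 𝐛 𝟎 = refl
swap-≻ᴹ 𝐛 𝐧 = refl
swap-≻ᴹ 𝐛 𝐛 = refl
swap-≻ᴹ 𝐛 𝟏 = refl
swap-≻ᴹ 𝟏 y = refl

⟦⟧-swap : ∀ a v → ⟦ a ⟧ (swap ∘ v) ≡ swap (⟦ a ⟧ v)
⟦⟧-swap (var p) v = refl
⟦⟧-swap (~ a)   v = trans (cong ¬ᴹ (⟦⟧-swap a v)) (sym (swap-¬ᴹ (⟦ a ⟧ v)))
⟦⟧-swap (a ⊃ b) v =
  trans (cong₂ _≻ᴹ_ (⟦⟧-swap a v) (⟦⟧-swap b v)) (sym (swap-≻ᴹ (⟦ a ⟧ v) (⟦ b ⟧ v)))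

designated-swap⇒𝟏 : ∀ x → IsTrue (designated x) → IsTrue (designated (swap x)) → x ≡ 𝟏
designated-swap⇒𝟏 𝟏 _ _ = refl

F-unsatisfiable⇒valid : ∀ α → (∀ v → ¬ Satisfies v (F α)) → Valid α
F-unsatisfiable⇒valid α unsat v = designated-swap⇒𝟏 (⟦ α ⟧ v)
  (¬IsTrue-not⇒IsTrue _ (unsat v))
  (subst (IsTrue ∘ designated) (⟦⟧-swap α v) (¬IsTrue-not⇒IsTrue _ (unsat (swap ∘ v))))

_≟ᶠ_ : DecidableEquality Fm
var p   ≟ᶠ var q   = map′ (cong var) (λ { refl → refl }) (p ℕ.≟ q)
(~ a)   ≟ᶠ (~ b)   = map′ (cong ~_) (λ { refl → refl }) (a ≟ᶠ b)
(a ⊃ b) ≟ᶠ (c ⊃ d) =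
  map′ (λ (a≡c , b≡d) → cong₂ _⊃_ a≡c b≡d) (λ { refl → refl , refl }) (a ≟ᶠ c ×-dec b ≟ᶠ d)
var _   ≟ᶠ (~ _)   = no λ ()
var _   ≟ᶠ (_ ⊃ _) = no λ ()
(~ _)   ≟ᶠ var _   = no λ ()
(~ _)   ≟ᶠ (_ ⊃ _) = no λ ()
(_ ⊃ _) ≟ᶠ var _   = no λ ()
(_ ⊃ _) ≟ᶠ (~ _)   = no λ ()

_≟ˢ_ : DecidableEquality SFm
T a ≟ˢ T b = map′ (cong T) (λ { refl → refl }) (a ≟ᶠ b)
F a ≟ˢ F b = map′ (cong F) (λ { refl → refl }) (a ≟ᶠ b)
T _ ≟ˢ F _ = no λ ()
F _ ≟ˢ T _ = no λ ()

Clashes-in : List SFm → SFm → Set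
Clashes-in ns (T γ) = F γ ∈ ns
Clashes-in ns (F γ) = ⊥

clashes-in? : ∀ ns φ → Dec (Clashes-in ns φ)
clashes-in? ns (T γ) = any? (F γ ≟ˢ_) ns
clashes-in? ns (F γ) = no λ ()

closed? : ∀ b → Dec (Closed b)
closed? b = map′ clash⇒closed (λ (γ , Tγ∈b , Fγ∈b) → lose Tγ∈b Fγ∈b)
                  (any? (clashes-in? (nodes b)) (nodes b))
  where
  clash⇒closed : Any (Clashes-in (nodes b)) (nodes b) → Closed b
  clash⇒closed c with find c
  ... | T γ , Tγ∈b , Fγ∈b = γ , Tγ∈b , Fγ∈b

open? : ∀ bs → Dec (Open bs)
open? bs = map′ find (λ (b , b∈bs , ¬closed) → lose b∈bs ¬closed) (any? (¬? ∘ closed?) bs)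

proposition5p4 : (α : Fm) → ¬ Valid α →
    (bs : List Branch) → Tableau (F α) bs → Completed bs → Open bs
proposition5p4 α ¬valid bs tableau _ = decidable-stable (open? bs) λ ¬open →
  ¬valid (F-unsatisfiable⇒valid α (λ v → ¬open⇒unsatisfiable v tableau ¬open))
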